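{- Let $A$ and $B$ be two disjoint independent sets in a graph $G$ with $|A|=|B|=\alpha(G)$. Let $M$ be a matching in $G$ each of whose edges has one end in $V(G)\setminus(A\cup B)$ and the other in $B$, of maximum possible size among such matchings. Let $B'\subseteq B\setminus V(M)$ and $G'=\mathbf{Sym}(G\mid A,B')$. Then $\alpha(G')=\alpha(G)$.
   Context: For disjoint $A,B'\subseteq V(G)$, $\mathbf{Sym}(G\mid A,B')$ is the graph on $V(G)$ obtained from $G$ by deleting all edges meeting $B'$ and then adding all edges $\{a,b\}$ with $a\in A$, $b\in B'$. $\alpha$ denotes independence number; $V(M)$ is the set of vertices covered by $M$. -}

module Defs where

open import Data.Nat using (ℕ; _≤_)
open import Data.Bool using (Bool; true; false; _∧_; _∨_; not; T)
open import Data.Fin using (Fin)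
open import Data.Fin.Subset using (Subset; _∈_; _∉_; ∣_∣; Empty; _∩_; _⊆_)
open import Data.Vec using (lookup)
open import Data.List using (List; length; concatMap; _∷_; [])
open import Data.List.Relation.Unary.All using (All)
open import Data.List.Relation.Unary.Unique.Propositional using (Unique)
open import Data.Product using (_×_; _,_; Σ; ∃)
open import Relation.Binary.PropositionalEquality using (_≡_; refl; cong₂)
open import Data.Bool.Properties using (∧-comm; ∨-comm; ∨-assoc)
open import Data.Vec.Properties using (lookup⇒[]=)
open import Data.Empty using (⊥-elim)
open import Relation.Nullary using (¬_)

record Graph (n : ℕ) : Set where
  field
    adj   : Fin n → Fin n → Bool
    sym   : ∀ u v → adj u v ≡ adj v u
    irref : ∀ v → adj v v ≡ false
open Graph public

Edge : ∀ {n} → Graph n → Fin n → Fin n → Set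
Edge G u v = T (adj G u v)

Independent : ∀ {n} → Graph n → Subset n → Set
Independent G S = ∀ u v → u ∈ S → v ∈ S → ¬ Edge G u v

IsIndependenceNumber : ∀ {n} → Graph n → ℕ → Set
IsIndependenceNumber {n} G k =
  (Σ (Subset n) λ S → Independent G S × ∣ S ∣ ≡ k) ×
  (∀ (S : Subset n) → Independent G S → ∣ S ∣ ≤ k)

Disjoint : ∀ {n} → Subset n → Subset n → Set
Disjoint A B = Empty (A ∩ B)

mem : ∀ {n} → Subset n → Fin n → Bool
mem S v = lookup S v

-- Sym(G | A, B'): delete all edges meeting B', then add all edges {a,b}
-- with a ∈ A, b ∈ B'.
symAdj : ∀ {n} → Graph n → Subset n → Subset n → Fin n → Fin n → Bool
symAdj G A B' u v =
  (adj G u v ∧ not (mem B' u) ∧ not (mem B' v))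
  ∨ (mem A u ∧ mem B' v) ∨ (mem B' u ∧ mem A v)

Matching : ℕ → Set
Matching n = List (Fin n × Fin n)

coveredVertices : ∀ {n} → Matching n → List (Fin n)
coveredVertices = concatMap (λ { (u , b) → u ∷ b ∷ [] })

data InV {n} (v : Fin n) : Matching n → Set where
  here₁ : ∀ {b M} → InV v ((v , b) ∷ M)
  here₂ : ∀ {u M} → InV v ((u , v) ∷ M)
  there : ∀ {e M} → InV v M → InV v (e ∷ M)

-- M is a matching in G each of whose edges (u , b) has u ∈ V(G) ∖ (A ∪ B)
-- and b ∈ B.  (Edges pairwise disjoint ⇔ covered vertices list is duplicate-free.)
IsABMatching : ∀ {n} → Graph n → Subset n → Subset n → Matching n → Set
IsABMatching G A B M =
  All (λ { (u , b) → Edge G u b × u ∉ A × u ∉ B × b ∈ B }) M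
  × Unique (coveredVertices M)

IsMaxABMatching : ∀ {n} → Graph n → Subset n → Subset n → Matching n → Set
IsMaxABMatching G A B M =
  IsABMatching G A B M × (∀ M' → IsABMatching G A B M' → length M' ≤ length M)

private
  symAdj-sym : ∀ {n} (G : Graph n) A B' u v → symAdj G A B' u v ≡ symAdj G A B' v u
  symAdj-sym G A B' u v with adj G u v | adj G v u | sym G u v | mem A u | mem A v | mem B' u | mem B' v
  ... | x | .x | refl | true  | true  | true  | true  = refl
  ... | x | .x | refl | true  | true  | true  | false = refl
  ... | x | .x | refl | true  | true  | false | true  = refl
  ... | x | .x | refl | true  | true  | false | false = refl
  ... | x | .x | refl | true  | false | true  | true  = refl
  ... | x | .x | refl | true  | false | true  | false = refl
  ... | x | .x | refl | true  | false | false | true  = refl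
  ... | x | .x | refl | true  | false | false | false = refl
  ... | x | .x | refl | false | true  | true  | true  = refl
  ... | x | .x | refl | false | true  | true  | false = refl
  ... | x | .x | refl | false | true  | false | true  = refl
  ... | x | .x | refl | false | true  | false | false = refl
  ... | x | .x | refl | false | false | true  | true  = refl
  ... | x | .x | refl | false | false | true  | false = refl
  ... | x | .x | refl | false | false | false | true  = refl
  ... | x | .x | refl | false | false | false | false = refl

  symAdj-irr : ∀ {n} (G : Graph n) A B' → (∀ v → v ∈ A → v ∉ B') →
               ∀ v → symAdj G A B' v v ≡ false
  symAdj-irr G A B' d v with adj G v v | irref G v | mem A v in ea | mem B' v in eb
  ... | .false | refl | false | false = refl
  ... | .false | refl | false | true  = refl
  ... | .false | refl | true  | false = refl
  ... | .false | refl | true  | true  =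
    ⊥-elim (d v (lookup⇒[]= v A ea) (lookup⇒[]= v B' eb))

Sym : ∀ {n} (G : Graph n) (A B' : Subset n) → (∀ v → v ∈ A → v ∉ B') → Graph n
Sym G A B' d = record { adj = symAdj G A B' ; sym = symAdj-sym G A B' ; irref = symAdj-irr G A B' d }

module Submission where

-- Let S be independent in G' = Sym(G | A, B'); we show ∣ S ∣ ≤ α(G) (and A
-- itself is independent in G', giving the lower bound).  Every vertex of
-- U = S ∩ B' is a vertex of B uncovered by the maximum A-B matching M, and
-- if U ≠ ∅ then S avoids A, as G' joins all of A to all of B'.
--
-- We run an exchange process on a pair (T , U), starting from (S , S ∩ B').
-- While some u ∈ U has a G-neighbour c ∈ T ∖ B, a maximum matching Mᵤ with u
-- uncovered must match c to some b₁ ∈ B (otherwise cu augments Mᵤ);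
-- redirecting that edge to u gives a maximum matching uncovering b₁.  We
-- replace c by b₁ in T and add b₁ to U.  The record Invariant lists what is
-- preserved; ∣ T ∣ never changes and ∣ U ∣ grows, so the process stops with
-- T independent in G, whence ∣ S ∣ = ∣ T ∣ ≤ α(G).

open import Defs
open import Data.Nat using (ℕ; zero; suc; _≤_; _+_)
open import Data.Nat.Properties using (1+n≰n; m≤n+m; +-suc; +-identityʳ; module ≤-Reasoning)
open import Data.Fin using (Fin; zero; suc; _≟_)
open import Data.Fin.Subset using (Subset; _∈_; _∉_; _⊆_; _∩_; ∣_∣; inside; outside)
open import Data.Fin.Subset.Properties using (_∈?_; x∈p∩q⁺; x∈p∩q⁻; ∣p∣≤n)
open import Data.Fin.Properties using (any?)
import Data.Vec as Vec
open import Data.Vec using (Vec; _∷_; _[_]=_; _[_]≔_; lookup)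
open import Data.Vec.Properties using ([]=-injective; []=⇒lookup; []≔-updates; []≔-minimal; lookup⇒[]=)
open import Data.List using (List; length; _∷_; [])
open import Data.List.Properties using (length-∷=)
open import Data.List.Membership.Propositional using (_∷=_) renaming (_∈_ to _∈ₗ_)
open import Data.List.Relation.Unary.Any using (here; there; index)
open import Data.List.Relation.Unary.All using (All; _∷_; [])
import Data.List.Relation.Unary.All as All
open import Data.List.Relation.Unary.Unique.Propositional using (Unique)
open import Data.List.Relation.Unary.AllPairs using (_∷_)
open import Data.Bool using (true; false; T)
open import Data.Bool.Properties using (∧-zeroʳ; ∧-identityʳ; ∨-identityʳ)
open import Data.Empty using (⊥; ⊥-elim)
open import Data.Sum using (_⊎_; inj₁; inj₂; [_,_]′)
open import Data.Product using (_×_; _,_; proj₁; proj₂; ∃)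
open import Function using (_∘_; _∘₂_)
open import Relation.Nullary using (¬_; Dec; yes; no)
open import Relation.Nullary.Decidable using (_×-dec_; ¬?; T?)
open import Relation.Binary.PropositionalEquality using (_≡_; _≢_; refl; cong; subst; trans) renaming (sym to ≡-sym)

[]≔-minimal⁻ : ∀ {n} {A : Set} (xs : Vec A n) i j {x y : A} →
               i ≢ j → (xs [ j ]≔ y) [ i ]= x → xs [ i ]= x
[]≔-minimal⁻ xs i j i≢j updated =
  subst (xs [ i ]=_) ([]=-injective ([]≔-minimal xs i j i≢j original) updated) original
  where original = lookup⇒[]= i xs refl

insert : ∀ {n} → Fin n → Subset n → Subset n
insert x p = p [ x ]≔ inside

delete : ∀ {n} → Fin n → Subset n → Subset n
delete x p = p [ x ]≔ outside

module _ {n : ℕ} {p : Subset n} where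

  x∈insert-x : ∀ x → x ∈ insert x p
  x∈insert-x x = []≔-updates p x

  ∈-insert⁺ : ∀ x {y} → y ∈ p → y ∈ insert x p
  ∈-insert⁺ x {y} y∈p with y ≟ x
  ... | yes refl = x∈insert-x x
  ... | no y≢x   = []≔-minimal p y x y≢x y∈p

  ∈-insert⁻ : ∀ x {y} → y ∈ insert x p → y ≡ x ⊎ y ∈ p
  ∈-insert⁻ x {y} y∈ with y ≟ x
  ... | yes y≡x = inj₁ y≡x
  ... | no y≢x  = inj₂ ([]≔-minimal⁻ p y x y≢x y∈)

  ∈-delete⁺ : ∀ x {y} → y ≢ x → y ∈ p → y ∈ delete x p
  ∈-delete⁺ x {y} y≢x y∈p = []≔-minimal p y x y≢x y∈p

  ∈-delete⁻ : ∀ x {y} → y ∈ delete x p → y ≢ x × y ∈ p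
  ∈-delete⁻ x {y} y∈ with y ≟ x
  ... | yes refl with () ← []=-injective ([]≔-updates p x) y∈
  ... | no y≢x = y≢x , []≔-minimal⁻ p y x y≢x y∈

∣insert∣ : ∀ {n} (p : Subset n) x → x ∉ p → ∣ insert x p ∣ ≡ suc ∣ p ∣
∣insert∣ (true  ∷ p) zero    x∉p = ⊥-elim (x∉p Vec.here)
∣insert∣ (false ∷ p) zero    x∉p = refl
∣insert∣ (true  ∷ p) (suc x) x∉p = cong suc (∣insert∣ p x (x∉p ∘ Vec.there))
∣insert∣ (false ∷ p) (suc x) x∉p = ∣insert∣ p x (x∉p ∘ Vec.there)

∣delete∣ : ∀ {n} (p : Subset n) x → x ∈ p → suc ∣ delete x p ∣ ≡ ∣ p ∣
∣delete∣ (true  ∷ p) zero    _ = refl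
∣delete∣ (true  ∷ p) (suc x) (Vec.there x∈p) = cong suc (∣delete∣ p x x∈p)
∣delete∣ (false ∷ p) (suc x) (Vec.there x∈p) = ∣delete∣ p x x∈p

replace : ∀ {n} → Fin n → Fin n → Subset n → Subset n
replace c b p = insert b (delete c p)

module _ {n : ℕ} {p : Subset n} {c b : Fin n} where

  ∣replace∣ : c ∈ p → b ∉ p → ∣ replace c b p ∣ ≡ ∣ p ∣
  ∣replace∣ c∈p b∉p = trans (∣insert∣ (delete c p) b (b∉p ∘ proj₂ ∘ ∈-delete⁻ c)) (∣delete∣ p c c∈p)

  ∈-replace⁺ : ∀ {y} → y ≢ c → y ∈ p → y ∈ replace c b p
  ∈-replace⁺ y≢c y∈p = ∈-insert⁺ b (∈-delete⁺ c y≢c y∈p)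

  ∈-replace⁻ : ∀ {y} → y ∈ replace c b p → y ≡ b ⊎ (y ≢ c × y ∈ p)
  ∈-replace⁻ y∈ with ∈-insert⁻ b y∈
  ... | inj₁ y≡b   = inj₁ y≡b
  ... | inj₂ y∈p-c = inj₂ (∈-delete⁻ c y∈p-c)

∉⇒outside : ∀ {n} {p : Subset n} {x} → x ∉ p → lookup p x ≡ outside
∉⇒outside {p = p} {x} x∉p with lookup p x in eq
... | true  = ⊥-elim (x∉p (lookup⇒[]= x p eq))
... | false = refl

∈-∷=⁻ : ∀ {A : Set} {xs : List A} {x y v : A} (x∈xs : x ∈ₗ xs) →
        y ∈ₗ (x∈xs ∷= v) → y ≡ v ⊎ y ∈ₗ xs
∈-∷=⁻ (here _)     (here y≡v)  = inj₁ y≡v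
∈-∷=⁻ (here _)     (there y∈)  = inj₂ (there y∈)
∈-∷=⁻ (there x∈xs) (here y≡z)  = inj₂ (here y≡z)
∈-∷=⁻ (there x∈xs) (there y∈) with ∈-∷=⁻ x∈xs y∈
... | inj₁ y≡v   = inj₁ y≡v
... | inj₂ y∈xs  = inj₂ (there y∈xs)

All-∷= : ∀ {A : Set} {P : A → Set} {xs : List A} {x v : A} (x∈xs : x ∈ₗ xs) →
         All P xs → P v → All P (x∈xs ∷= v)
All-∷= (here _)     (_  ∷ pxs) pv = pv ∷ pxs
All-∷= (there x∈xs) (px ∷ pxs) pv = px ∷ All-∷= x∈xs pxs pv

module ABMatchings {n : ℕ} (G : Graph n) (A B : Subset n) where

  ABEdge : Fin n × Fin n → Set
  ABEdge (u , b) = Edge G u b × u ∉ A × u ∉ B × b ∈ B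

  covers-first : ∀ {M : Matching n} {a b} → (a , b) ∈ₗ M → InV a M
  covers-first (here refl) = here₁
  covers-first (there e∈M) = there (covers-first e∈M)

  covers-second : ∀ {M : Matching n} {a b} → (a , b) ∈ₗ M → InV b M
  covers-second (here refl) = here₂
  covers-second (there e∈M) = there (covers-second e∈M)

  covering-edge : ∀ {M : Matching n} {v} → InV v M → (∃ λ b → (v , b) ∈ₗ M) ⊎ (∃ λ a → (a , v) ∈ₗ M)
  covering-edge here₁ = inj₁ (_ , here refl)
  covering-edge here₂ = inj₂ (_ , here refl)
  covering-edge (there v∈M) with covering-edge v∈M
  ... | inj₁ (b , e∈M) = inj₁ (b , there e∈M)
  ... | inj₂ (a , e∈M) = inj₂ (a , there e∈M)

  free⇒distinct : ∀ {v} (M : Matching n) → ¬ InV v M → All (v ≢_) (coveredVertices M)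
  free⇒distinct []            v∉M = []
  free⇒distinct ((a , b) ∷ M) v∉M =
    (λ { refl → v∉M here₁ }) ∷ (λ { refl → v∉M here₂ }) ∷ free⇒distinct M (λ v∈M → v∉M (there v∈M))

  distinct⇒free : ∀ {v} (M : Matching n) → All (v ≢_) (coveredVertices M) → ¬ InV v M
  distinct⇒free ((a , b) ∷ M) (v≢a ∷ v≢b ∷ _)  here₁       = v≢a refl
  distinct⇒free ((a , b) ∷ M) (v≢a ∷ v≢b ∷ _)  here₂       = v≢b refl
  distinct⇒free ((a , b) ∷ M) (_ ∷ _ ∷ v∉M)    (there v∈M) = distinct⇒free M v∉M v∈M

  InV? : ∀ v (M : Matching n) → Dec (InV v M)
  InV? v [] = no (λ ())
  InV? v ((a , b) ∷ M) with v ≟ a | v ≟ b | InV? v M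
  ... | yes refl | _        | _        = yes here₁
  ... | no _     | yes refl | _        = yes here₂
  ... | no _     | no _     | yes v∈M  = yes (there v∈M)
  ... | no v≢a   | no v≢b   | no v∉M   =
    no (λ { here₁ → v≢a refl ; here₂ → v≢b refl ; (there v∈M) → v∉M v∈M })

  same-second-end : ∀ {M : Matching n} {a a' b} → Unique (coveredVertices M) →
                    (a , b) ∈ₗ M → (a' , b) ∈ₗ M → a ≡ a'
  same-second-end _ (here refl) (here refl) = refl
  same-second-end {_ ∷ M} (_ ∷ b∉M ∷ _) (here refl) (there e∈M) =
    ⊥-elim (distinct⇒free M b∉M (covers-second e∈M))
  same-second-end {_ ∷ M} (_ ∷ b∉M ∷ _) (there e∈M) (here refl) =
    ⊥-elim (distinct⇒free M b∉M (covers-second e∈M))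
  same-second-end (_ ∷ _ ∷ unique) (there e∈M) (there e'∈M) = same-second-end unique e∈M e'∈M

  first-end-∉B : ∀ {M : Matching n} {a b} → IsABMatching G A B M → (a , b) ∈ₗ M → a ∉ B
  first-end-∉B (edges , _) e∈M = proj₁ (proj₂ (proj₂ (All.lookup edges e∈M)))

  second-end-∈B : ∀ {M : Matching n} {a b} → IsABMatching G A B M → (a , b) ∈ₗ M → b ∈ B
  second-end-∈B (edges , _) e∈M = proj₂ (proj₂ (proj₂ (All.lookup edges e∈M)))

  -- A maximum A-B matching has no augmenting edge: an A-B edge between two
  -- uncovered vertices could be added to it.
  no-augmenting-edge : ∀ {M : Matching n} {c u} → IsMaxABMatching G A B M → ABEdge (c , u) →
                       ¬ InV c M → ¬ InV u M → ⊥
  no-augmenting-edge {M} {c} {u} ((edges , unique) , maximal) cu@(_ , _ , c∉B , u∈B) c∉M u∉M =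
    1+n≰n (maximal ((c , u) ∷ M)
      (cu ∷ edges , (c≢u ∷ free⇒distinct M c∉M) ∷ free⇒distinct M u∉M ∷ unique))
    where
      c≢u : c ≢ u
      c≢u refl = c∉B u∈B

  matched-neighbour : ∀ {M : Matching n} {c u} → IsMaxABMatching G A B M → ABEdge (c , u) →
                      ¬ InV u M → ∃ λ b → (c , b) ∈ₗ M
  matched-neighbour {M} {c} M-max cu@(_ , _ , c∉B , _) u∉M with InV? c M
  ... | no c∉M = ⊥-elim (no-augmenting-edge M-max cu c∉M u∉M)
  ... | yes c∈M with covering-edge c∈M
  ...   | inj₁ partner      = partner
  ...   | inj₂ (_ , e∈M)   = ⊥-elim (c∉B (second-end-∈B (proj₁ M-max) e∈M))

  redirect : ∀ {M : Matching n} {c b₁} → (c , b₁) ∈ₗ M → Fin n → Matching n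
  redirect {c = c} e∈M u = e∈M ∷= (c , u)

  InV-redirect : ∀ {M : Matching n} {c b₁ u v} (e∈M : (c , b₁) ∈ₗ M) →
                 InV v (redirect e∈M u) → InV v M ⊎ v ≡ u
  InV-redirect e∈M v∈M' with covering-edge v∈M'
  ... | inj₁ (_ , e'∈M') with ∈-∷=⁻ e∈M e'∈M'
  ...   | inj₁ refl = inj₁ (covers-first e∈M)
  ...   | inj₂ e'∈M = inj₁ (covers-first e'∈M)
  InV-redirect e∈M v∈M' | inj₂ (_ , e'∈M') with ∈-∷=⁻ e∈M e'∈M'
  ...   | inj₁ refl = inj₂ refl
  ...   | inj₂ e'∈M = inj₁ (covers-second e'∈M)

  unique-redirect : ∀ {M : Matching n} {c b₁ u} (e∈M : (c , b₁) ∈ₗ M) →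
                    Unique (coveredVertices M) → ¬ InV u M → Unique (coveredVertices (redirect e∈M u))
  unique-redirect {_ ∷ M} (here refl) ((_ ∷ c∉M) ∷ _ ∷ unique) u∉ =
    ((λ { refl → u∉ here₁ }) ∷ c∉M) ∷ free⇒distinct M (λ u∈M → u∉ (there u∈M)) ∷ unique
  unique-redirect {(x , y) ∷ M} {u = u} (there e∈M) ((x≢y ∷ x∉M) ∷ y∉M ∷ unique) u∉ =
    (x≢y ∷ free⇒distinct _ (stays-free x∉M here₁)) ∷ free⇒distinct _ (stays-free y∉M here₂) ∷
    unique-redirect e∈M unique (λ u∈M → u∉ (there u∈M))
    where
      stays-free : ∀ {w} → All (w ≢_) (coveredVertices M) → InV w ((x , y) ∷ M) →
                   ¬ InV w (redirect e∈M u)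
      stays-free w∉M w∈ w∈M' with InV-redirect e∈M w∈M'
      ... | inj₁ w∈M  = distinct⇒free M w∉M w∈M
      ... | inj₂ refl = u∉ w∈

  freed-by-redirect : ∀ {M : Matching n} {c b₁ u} (e∈M : (c , b₁) ∈ₗ M) →
                      IsABMatching G A B M → ¬ InV u M → ¬ InV b₁ (redirect e∈M u)
  freed-by-redirect (here refl) ((_ , _ , c∉B , c∈B) ∷ _ , _) u∉ here₁ = c∉B c∈B
  freed-by-redirect (here refl) _ u∉ here₂ = u∉ here₂
  freed-by-redirect {_ ∷ M} (here refl) (_ , _ ∷ b₁∉M ∷ _) u∉ (there b₁∈M) =
    distinct⇒free M b₁∉M b₁∈M
  freed-by-redirect {_ ∷ M} (there e∈M) (_ , (_ ∷ x∉M) ∷ _) u∉ here₁ =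
    distinct⇒free M x∉M (covers-second e∈M)
  freed-by-redirect {_ ∷ M} (there e∈M) (_ , _ ∷ y∉M ∷ _) u∉ here₂ =
    distinct⇒free M y∉M (covers-second e∈M)
  freed-by-redirect (there e∈M) (_ ∷ edges , _ ∷ _ ∷ unique) u∉ (there b₁∈M') =
    freed-by-redirect e∈M (edges , unique) (λ u∈M → u∉ (there u∈M)) b₁∈M'

  redirect-maximum : ∀ {M : Matching n} {c b₁ u} (e∈M : (c , b₁) ∈ₗ M) → IsMaxABMatching G A B M →
                     Edge G c u → u ∈ B → ¬ InV u M → IsMaxABMatching G A B (redirect e∈M u)
  redirect-maximum {M} e∈M ((edges , unique) , maximal) cu u∈B u∉M =
    let (_ , c∉A , c∉B , _) = All.lookup edges e∈M in
    (All-∷= e∈M edges (cu , c∉A , c∉B , u∈B) , unique-redirect e∈M unique u∉M) ,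
    λ M' M'-ok → subst (length M' ≤_) (≡-sym (length-∷= M (index e∈M) _)) (maximal M' M'-ok)

module Invariants {n : ℕ} (G : Graph n) (A B : Subset n) (M₀ : Matching n) where

  record Witness (T : Subset n) (u : Fin n) : Set where
    field
      matching : Matching n
      maximum  : IsMaxABMatching G A B matching
      u-free   : ¬ InV u matching
      agrees   : ∀ {c b} → c ∈ T → (c , b) ∈ₗ matching → (c , b) ∈ₗ M₀

  record Invariant (T U : Subset n) : Set where
    field
      U⊆T               : U ⊆ T
      U⊆B               : U ⊆ B
      avoids-A          : ∀ {u v} → u ∈ U → v ∈ T → v ∉ A
      independent-off-U : ∀ {x y} → x ∈ T → y ∈ T → x ∉ U → y ∉ U → ¬ Edge G x y
      witness           : ∀ {u} → u ∈ U → Witness T u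
      M₀-avoids-U       : ∀ {c u} → u ∈ U → c ∈ T → ¬ (c , u) ∈ₗ M₀

module Exchange {n : ℕ} (G : Graph n) (A B : Subset n) (M₀ : Matching n)
  (M₀-max : IsMaxABMatching G A B M₀) (B-independent : Independent G B) (A∩B=∅ : Disjoint A B) where

  open ABMatchings G A B
  open Invariants G A B M₀ public

  edge-sym : ∀ {x y} → Edge G x y → Edge G y x
  edge-sym {x} {y} = subst T (sym G x y)

  -- The obstruction to T being independent: a G-edge from u ∈ U to c ∈ T ∖ B.
  Conflict : Subset n → Subset n → Set
  Conflict T U = ∃ λ u → ∃ λ c → u ∈ U × c ∈ T × c ∉ B × Edge G c u

  conflict? : ∀ T U → Dec (Conflict T U)
  conflict? T U = any? λ u → any? λ c → (u ∈? U) ×-dec (c ∈? T) ×-dec ¬? (c ∈? B) ×-dec T? (adj G c u)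

  -- Without conflicts no edge leaves U inside T: edges into B are excluded
  -- by the independence of B, the others would be conflicts.
  no-edge-from-U : ∀ {T U u v} → Invariant T U → ¬ Conflict T U → u ∈ U → v ∈ T → ¬ Edge G u v
  no-edge-from-U {u = u} {v} inv no-conflict u∈U v∈T uv with v ∈? B
  ... | yes v∈B = B-independent u v (Invariant.U⊆B inv u∈U) v∈B uv
  ... | no v∉B  = no-conflict (u , v , u∈U , v∈T , v∉B , edge-sym uv)

  no-conflict⇒independent : ∀ {T U} → Invariant T U → ¬ Conflict T U → Independent G T
  no-conflict⇒independent {U = U} inv no-conflict x y x∈T y∈T xy with x ∈? U | y ∈? U
  ... | yes x∈U | _       = no-edge-from-U inv no-conflict x∈U y∈T xy
  ... | no _    | yes y∈U = no-edge-from-U inv no-conflict y∈U x∈T (edge-sym xy)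
  ... | no x∉U  | no y∉U  = Invariant.independent-off-U inv x∈T y∈T x∉U y∉U xy

  -- Agreement with M₀ only concerns first ends of edges, which lie outside
  -- B; so a witness for T is one for any T' whose part outside B lies in T.
  restrict-witness : ∀ {T T' u} → (∀ {x} → x ∈ T' → x ∉ B → x ∈ T) → Witness T u → Witness T' u
  restrict-witness T'∖B⊆T w = record
    { matching = matching ; maximum = maximum ; u-free = u-free
    ; agrees   = λ c∈T' e∈M → agrees (T'∖B⊆T c∈T' (first-end-∉B (proj₁ maximum) e∈M)) e∈M }
    where open Witness w

  module Step {T U : Subset n} (inv : Invariant T U) {u c : Fin n}
              (u∈U : u ∈ U) (c∈T : c ∈ T) (c∉B : c ∉ B) (cu : Edge G c u) where
    open Invariant inv
    open Witness (witness u∈U) using ()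
      renaming (matching to Mᵤ; maximum to Mᵤ-max; u-free to u∉Mᵤ; agrees to Mᵤ-agrees)

    u∈B : u ∈ B
    u∈B = U⊆B u∈U

    c∉U : c ∉ U
    c∉U = c∉B ∘ U⊆B

    -- Mᵤ matches c to some b₁ (else cu would augment it); M₀ has this edge too.
    partner : ∃ λ b₁ → (c , b₁) ∈ₗ Mᵤ
    partner = matched-neighbour Mᵤ-max (cu , avoids-A u∈U c∈T , c∉B , u∈B) u∉Mᵤ

    b₁ : Fin n
    b₁ = proj₁ partner

    cb₁∈Mᵤ : (c , b₁) ∈ₗ Mᵤ
    cb₁∈Mᵤ = proj₂ partner

    cb₁∈M₀ : (c , b₁) ∈ₗ M₀
    cb₁∈M₀ = Mᵤ-agrees c∈T cb₁∈Mᵤ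

    b₁∈B : b₁ ∈ B
    b₁∈B = second-end-∈B (proj₁ Mᵤ-max) cb₁∈Mᵤ

    -- b₁ ∉ U since M₀ matches c ∈ T to it, and b₁ ∉ T ∖ U since cb₁ is an edge.
    b₁∉T : b₁ ∉ T
    b₁∉T b₁∈T = independent-off-U c∈T b₁∈T c∉U (λ b₁∈U → M₀-avoids-U b₁∈U c∈T cb₁∈M₀)
                  (proj₁ (All.lookup (proj₁ (proj₁ Mᵤ-max)) cb₁∈Mᵤ))

    T' U' : Subset n
    T' = replace c b₁ T
    U' = insert b₁ U

    ∣T'∣ : ∣ T' ∣ ≡ ∣ T ∣
    ∣T'∣ = ∣replace∣ c∈T b₁∉T

    ∣U'∣ : ∣ U' ∣ ≡ suc ∣ U ∣
    ∣U'∣ = ∣insert∣ U b₁ (b₁∉T ∘ U⊆T)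

    T'∖B⊆T-c : ∀ {x} → x ∈ T' → x ∉ B → x ∈ T × x ≢ c
    T'∖B⊆T-c x∈T' x∉B with ∈-replace⁻ x∈T'
    ... | inj₁ refl          = ⊥-elim (x∉B b₁∈B)
    ... | inj₂ (x≢c , x∈T)   = x∈T , x≢c

    T'∖U'⊆T∖U : ∀ {x} → x ∈ T' → x ∉ U' → x ∈ T × x ∉ U
    T'∖U'⊆T∖U x∈T' x∉U' with ∈-replace⁻ x∈T'
    ... | inj₁ refl          = ⊥-elim (x∉U' (x∈insert-x b₁))
    ... | inj₂ (_ , x∈T)     = x∈T , x∉U' ∘ ∈-insert⁺ b₁

    M' : Matching n
    M' = redirect cb₁∈Mᵤ u

    new-witness : Witness T' b₁
    new-witness = record
      { matching = M'
      ; maximum  = M'-max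
      ; u-free   = freed-by-redirect cb₁∈Mᵤ (proj₁ Mᵤ-max) u∉Mᵤ
      ; agrees   = agrees' }
      where
        M'-max : IsMaxABMatching G A B M'
        M'-max = redirect-maximum cb₁∈Mᵤ Mᵤ-max cu u∈B u∉Mᵤ
        agrees' : ∀ {c' b} → c' ∈ T' → (c' , b) ∈ₗ M' → (c' , b) ∈ₗ M₀
        agrees' c'∈T' e∈M' with T'∖B⊆T-c c'∈T' (first-end-∉B (proj₁ M'-max) e∈M') | ∈-∷=⁻ cb₁∈Mᵤ e∈M'
        ... | _    , c'≢c | inj₁ refl = ⊥-elim (c'≢c refl)
        ... | c'∈T , _    | inj₂ e∈Mᵤ = Mᵤ-agrees c'∈T e∈Mᵤ

    -- M₀ matches nothing of T' into U': for b₁, its M₀-partner is c ∉ T'.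
    M₀-avoids-U' : ∀ {c' u'} → u' ∈ U' → c' ∈ T' → ¬ (c' , u') ∈ₗ M₀
    M₀-avoids-U' u'∈U' c'∈T' e∈M₀ with T'∖B⊆T-c c'∈T' (first-end-∉B (proj₁ M₀-max) e∈M₀) | ∈-insert⁻ b₁ u'∈U'
    ... | _    , c'≢c | inj₁ refl = c'≢c (same-second-end (proj₂ (proj₁ M₀-max)) e∈M₀ cb₁∈M₀)
    ... | c'∈T , _    | inj₂ u'∈U = M₀-avoids-U u'∈U c'∈T e∈M₀

    U'⊆T' : U' ⊆ T'
    U'⊆T' x∈U' with ∈-insert⁻ b₁ x∈U'
    ... | inj₁ refl = x∈insert-x b₁
    ... | inj₂ x∈U  = ∈-replace⁺ (λ { refl → c∉U x∈U }) (U⊆T x∈U)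

    U'⊆B : U' ⊆ B
    U'⊆B x∈U' = [ (λ { refl → b₁∈B }) , U⊆B ]′ (∈-insert⁻ b₁ x∈U')

    -- T' still avoids A: b₁ ∈ B, and T avoids A since u ∈ U.
    T'∩A=∅ : ∀ {v} → v ∈ T' → v ∉ A
    T'∩A=∅ v∈T' v∈A with ∈-replace⁻ v∈T'
    ... | inj₁ refl      = A∩B=∅ (_ , x∈p∩q⁺ (v∈A , b₁∈B))
    ... | inj₂ (_ , v∈T) = avoids-A u∈U v∈T v∈A

    -- Old witnesses survive, since T' ∖ B ⊆ T; b₁ gets the new witness.
    witness' : ∀ {u'} → u' ∈ U' → Witness T' u'
    witness' u'∈U' with ∈-insert⁻ b₁ u'∈U'
    ... | inj₁ refl = new-witness
    ... | inj₂ u'∈U = restrict-witness (proj₁ ∘₂ T'∖B⊆T-c) (witness u'∈U)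

    invariant' : Invariant T' U'
    invariant' = record
      { U⊆T               = U'⊆T'
      ; U⊆B               = U'⊆B
      ; avoids-A          = λ _ → T'∩A=∅
      ; independent-off-U = λ x∈T' y∈T' x∉U' y∉U' →
          let (x∈T , x∉U) = T'∖U'⊆T∖U x∈T' x∉U' ; (y∈T , y∉U) = T'∖U'⊆T∖U y∈T' y∉U'
          in independent-off-U x∈T y∈T x∉U y∉U
      ; witness           = witness'
      ; M₀-avoids-U       = M₀-avoids-U' }

  exchange-step : ∀ {T U} → Invariant T U → Conflict T U →
                  ∃ λ T' → ∃ λ U' → ∣ T' ∣ ≡ ∣ T ∣ × ∣ U' ∣ ≡ suc ∣ U ∣ × Invariant T' U'
  exchange-step inv (u , c , u∈U , c∈T , c∉B , cu) = T' , U' , ∣T'∣ , ∣U'∣ , invariant'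
    where open Step inv u∈U c∈T c∉B cu

  -- Since ∣ U ∣ ≤ n, at most n steps lead to a conflict-free, hence
  -- G-independent, set of the same size as T.
  bounded : ∀ {k} → (∀ S → Independent G S → ∣ S ∣ ≤ k) → ∀ {T U} → Invariant T U → ∣ T ∣ ≤ k
  bounded {k} α≤k {T} {U} = run n T U (m≤n+m n ∣ U ∣)
    where
      run : ∀ fuel T U → n ≤ ∣ U ∣ + fuel → Invariant T U → ∣ T ∣ ≤ k
      run fuel T U room inv with conflict? T U
      ... | no none = α≤k T (no-conflict⇒independent inv none)
      ... | yes conflict with exchange-step inv conflict | fuel
      ...   | T' , U' , ∣T'∣≡∣T∣ , ∣U'∣≡1+∣U∣ , inv' | zero = ⊥-elim (1+n≰n (begin
                suc ∣ U ∣  ≡⟨ ≡-sym ∣U'∣≡1+∣U∣ ⟩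
                ∣ U' ∣     ≤⟨ ∣p∣≤n U' ⟩
                n          ≤⟨ room ⟩
                ∣ U ∣ + 0  ≡⟨ +-identityʳ ∣ U ∣ ⟩
                ∣ U ∣      ∎))
        where open ≤-Reasoning
      ...   | T' , U' , ∣T'∣≡∣T∣ , ∣U'∣≡1+∣U∣ , inv' | suc fuel' =
                subst (_≤ k) ∣T'∣≡∣T∣ (run fuel' T' U' room' inv')
        where
          open ≤-Reasoning
          room' : n ≤ ∣ U' ∣ + fuel'
          room' = begin
            n                  ≤⟨ room ⟩
            ∣ U ∣ + suc fuel'  ≡⟨ +-suc ∣ U ∣ fuel' ⟩
            suc ∣ U ∣ + fuel'  ≡⟨ cong (_+ fuel') (≡-sym ∣U'∣≡1+∣U∣) ⟩
            ∣ U' ∣ + fuel'     ∎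

module SymEdges {n : ℕ} (G : Graph n) (A B' : Subset n) (disj : ∀ v → v ∈ A → v ∉ B') where

  Sym-off-B' : ∀ {x y} → x ∉ B' → y ∉ B' → adj (Sym G A B' disj) x y ≡ adj G x y
  Sym-off-B' {x} {y} x∉B' y∉B'
    rewrite ∉⇒outside x∉B' | ∉⇒outside y∉B' | ∧-zeroʳ (mem A x)
          | ∧-identityʳ (adj G x y) | ∨-identityʳ (adj G x y) = refl

  Sym-joins : ∀ {a b} → a ∈ A → b ∈ B' → Edge (Sym G A B' disj) a b
  Sym-joins {a} {b} a∈A b∈B'
    rewrite []=⇒lookup a∈A | []=⇒lookup b∈B' | ∉⇒outside (disj a a∈A) | ∧-zeroʳ (adj G a b) = _

  independent-off-B' : ∀ {S} → (∀ {v} → v ∈ S → v ∉ B') → Independent G S →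
                       Independent (Sym G A B' disj) S
  independent-off-B' S∩B'=∅ S-ind x y x∈S y∈S =
    S-ind x y x∈S y∈S ∘ subst T (Sym-off-B' (S∩B'=∅ x∈S) (S∩B'=∅ y∈S))

initial-invariant : ∀ {n} (G : Graph n) (A B B' : Subset n) (M : Matching n) →
  IsMaxABMatching G A B M → (∀ v → v ∈ B' → v ∈ B × ¬ InV v M) →
  (disj : ∀ v → v ∈ A → v ∉ B') → ∀ {S} → Independent (Sym G A B' disj) S →
  Invariants.Invariant G A B M S (S ∩ B')
initial-invariant G A B B' M M-max B'-free disj {S} S-ind = record
  { U⊆T               = proj₁ ∘ in-U
  ; U⊆B               = proj₁ ∘ B'-free _ ∘ proj₂ ∘ in-U
  ; avoids-A          = λ u∈U v∈S v∈A → S-ind _ _ v∈S (proj₁ (in-U u∈U)) (Sym-joins v∈A (proj₂ (in-U u∈U)))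
  ; independent-off-U = λ x∈S y∈S x∉U y∉U → S-ind _ _ x∈S y∈S ∘ subst T (≡-sym
                          (Sym-off-B' (x∉U ∘ x∈p∩q⁺ ∘ (x∈S ,_)) (y∉U ∘ x∈p∩q⁺ ∘ (y∈S ,_))))
  ; witness           = λ u∈U → record
      { matching = M ; maximum = M-max ; u-free = u-free u∈U ; agrees = λ _ e∈M → e∈M }
  ; M₀-avoids-U       = λ u∈U _ e∈M → u-free u∈U (ABMatchings.covers-second G A B e∈M) }
  where
    open SymEdges G A B' disj
    in-U : ∀ {v} → v ∈ S ∩ B' → v ∈ S × v ∈ B'
    in-U = x∈p∩q⁻ S B'
    u-free : ∀ {u} → u ∈ S ∩ B' → ¬ InV u M
    u-free = proj₂ ∘ B'-free _ ∘ proj₂ ∘ in-U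

lemma2p5 : ∀ {n} (G : Graph n) (A B B' : Subset n) (M : Matching n) (k : ℕ) →
    IsIndependenceNumber G k →
    Independent G A → Independent G B → Disjoint A B →
    ∣ A ∣ ≡ k → ∣ B ∣ ≡ k →
    IsMaxABMatching G A B M →
    (∀ v → v ∈ B' → v ∈ B × ¬ InV v M) →
    (disj : ∀ v → v ∈ A → v ∉ B') →
    IsIndependenceNumber (Sym G A B' disj) k
lemma2p5 G A B B' M k (_ , α≤k) A-ind B-ind A∩B=∅ ∣A∣≡k _ M-max B'-free disj =
  (A , independent-off-B' (λ {v} → disj v) A-ind , ∣A∣≡k) ,
  λ S S-ind → Exchange.bounded G A B M M-max B-ind A∩B=∅ α≤k
                (initial-invariant G A B B' M M-max B'-free disj S-ind)
  where open SymEdges G A B' disj
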